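{- Let $X = \mathrm{Cay}(\mathbb{Z}_n, S)$ be a connected, nonbipartite circulant graph with $n \equiv 2 \pmod 4$. Then $X$ has Wilson type (C.1) (i.e., there is a nonzero $h \in 2\mathbb{Z}_n$ with $h + (S \cap 2\mathbb{Z}_n) = S \cap 2\mathbb{Z}_n$) if and only if $BX$ has an automorphism $\alpha$ such that $\alpha \notin \mathrm{Aut}\,X \times S_2$ and $\alpha$ fixes the set $2\mathbb{Z}_n \times \mathbb{Z}_2$ setwise.
   Context: All graphs are finite, simple and undirected. For $S \subseteq \mathbb{Z}_n$ with $-S = S$, $0 \notin S$, $\mathrm{Cay}(\mathbb{Z}_n,S)$ has vertex set $\mathbb{Z}_n$ with $v \sim w$ iff $w - v \in S$. The canonical bipartite double cover $BX$ has vertex set $\mathbb{Z}_n\times\{0,1\}$ (identified with $\mathbb{Z}_n \times \mathbb{Z}_2$), with $(v,0)\sim(w,1)$ iff $v\sim w$ in $X$. $\mathrm{Aut}\,X\times S_2$ is regarded as a subgroup of $\mathrm{Aut}\,BX$ via $(\varphi,\sigma)(v,i)=(\varphi(v),\sigma(i))$. -}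

module Defs where

open import Data.Nat as ℕ using (ℕ; NonZero)
open import Data.Nat.DivMod using (_%_; m%n<n)
open import Data.Fin using (Fin; toℕ; fromℕ<)
open import Data.Fin.Subset using (Subset; _∈_; _∉_)
open import Data.Bool using (Bool)
open import Data.Product using (Σ; ∃; ∃-syntax; _×_; _,_; proj₁; proj₂)
open import Relation.Binary.PropositionalEquality using (_≡_; _≢_)
open import Relation.Nullary using (¬_)
open import Function.Bundles using (_↔_; _⇔_; Inverse)

module _ (n : ℕ) .{{_ : NonZero n}} where

  ℤₙ : Set
  ℤₙ = Fin n

  mod : ℕ → ℤₙ
  mod m = fromℕ< (m%n<n m n)

  0ₙ : ℤₙ
  0ₙ = mod 0

module _ {n : ℕ} .{{_ : NonZero n}} where

  infixl 6 _⊕_ _⊖_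

  _⊕_ : Fin n → Fin n → Fin n
  a ⊕ b = mod n (toℕ a ℕ.+ toℕ b)

  ⊝_ : Fin n → Fin n
  ⊝ a = mod n (n ℕ.∸ toℕ a)

  _⊖_ : Fin n → Fin n → Fin n
  a ⊖ b = a ⊕ (⊝ b)

  IsConnectionSet : Subset n → Set
  IsConnectionSet S = (∀ x → x ∈ S → (⊝ x) ∈ S) × (0ₙ n ∉ S)

  Adj : Subset n → Fin n → Fin n → Set
  Adj S v w = (w ⊖ v) ∈ S

  data Walk (S : Subset n) : Fin n → Fin n → Set where
    nil  : ∀ {v} → Walk S v v
    cons : ∀ {u v w} → Adj S u v → Walk S v w → Walk S u w

  Connected : Subset n → Set
  Connected S = ∀ v w → Walk S v w

  Bipartite : Subset n → Set
  Bipartite S = Σ (Fin n → Bool) λ c → ∀ v w → Adj S v w → c v ≢ c w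

  NonBipartite : Subset n → Set
  NonBipartite S = ¬ Bipartite S

  In2ℤ : Fin n → Set
  In2ℤ x = ∃[ y ] (y ⊕ y ≡ x)

  InSEven : Subset n → Fin n → Set
  InSEven S x = (x ∈ S) × In2ℤ x

  WilsonC1 : Subset n → Set
  WilsonC1 S = ∃[ h ] (In2ℤ h × h ≢ 0ₙ n ×
                 (∀ x → InSEven S x ⇔ (∃[ a ] (InSEven S a × x ≡ h ⊕ a))))

  AutX : Subset n → Set
  AutX S = Σ (Fin n ↔ Fin n) λ φ →
             ∀ v w → Adj S v w ⇔ Adj S (Inverse.to φ v) (Inverse.to φ w)

  -- canonical bipartite double cover BX on ℤ_n × ℤ_2 (ℤ_2 ≅ Bool)
  BV : Set
  BV = Fin n × Bool

  BAdj : Subset n → BV → BV → Set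
  BAdj S (v , i) (w , j) = (i ≢ j) × Adj S v w

  AutBX : Subset n → Set
  AutBX S = Σ (BV ↔ BV) λ α →
              ∀ x y → BAdj S x y ⇔ BAdj S (Inverse.to α x) (Inverse.to α y)

  InAutX×S₂ : (S : Subset n) → AutBX S → Set
  InAutX×S₂ S α = Σ (AutX S) λ φ → Σ (Bool ↔ Bool) λ σ →
    ∀ v i → Inverse.to (proj₁ α) (v , i)
            ≡ (Inverse.to (proj₁ φ) v , Inverse.to σ i)

  FixesEvenSetwise : (S : Subset n) → AutBX S → Set
  FixesEvenSetwise S α = ∀ y → In2ℤ (proj₁ y) ⇔
    (∃[ x ] (In2ℤ (proj₁ x) × Inverse.to (proj₁ α) x ≡ y))

module Submission where

-- An automorphism α of BX fixing 2ℤ_n × ℤ_2 setwise preserves the parity of the ℤ_n-part, hence the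
-- relation Z of edges (x , a) ~ (y , b) with y - x ∈ S ∩ 2ℤ_n. Over GF(2), the square of the indicator
-- of S ∩ 2ℤ_n under convolution is that indicator composed with halving: in u + u′ = d the pairs
-- u ≠ u′ cancel, and since n/2 is odd an even d has exactly one even half. Halving permutes 2ℤ_n, so
-- a suitable power Z^(2^k) (in the relation algebra over GF(2)) is the relation Zᶠ = Z ∘ flip
-- joining (x , a) to (y , a); α preserves it as well. Thus α (v , 1) and flip (α (v , 0)) have the
-- same Z-neighbourhood. If they always coincide, connectedness forces α = (φ , σ). Otherwise the two
-- distinct twins differ by a nonzero even period of S ∩ 2ℤ_n (nonempty as X is not bipartite),
-- which is (C.1). Conversely, a period h gives the automorphism translating by h exactly the
-- vertices (v , i) with v ≡ i (mod 2).

open import Defs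
open import Level using (0ℓ)
open import Algebra.Bundles using (AbelianGroup; CommutativeRing; CommutativeMonoid)
open import Data.Bool as Bool using (Bool; true; false; _xor_; _∧_; not; if_then_else_)
open import Data.Bool.Properties
  using (xor-∧-commutativeRing; ∧-commutativeMonoid; ⇔→≡; ¬-not; not-¬; not-involutive; not-distribˡ-xor;
         xor-comm; xor-assoc; xor-identityʳ; xor-inverseʳ; xor-same; ∧-comm; ∧-zeroʳ; ∧-idem; ∧-identityʳ;
         ∧-distribʳ-xor; T-≡; T-not-≡)
open import Algebra.Properties.CommutativeSemigroup (CommutativeMonoid.commutativeSemigroup ∧-commutativeMonoid)
  using () renaming (interchange to ∧-interchange)
open import Data.Nat as ℕ using (ℕ; NonZero; _+_; _*_; _∸_; _^_; parity)
open import Data.Nat.Properties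
  using (+-assoc; +-comm; +-suc; +-identityʳ; *-comm; *-identityˡ; +-mono-<; ≤-antisym; ≤-<-trans; <⇒≤;
         ≮⇒≥; m≤m+n; n<1+n; m+n≡0⇒m≡0; m∸n≡0⇒m≤n; m∸n+n≡m; m+[n∸m]≡n; m<n+o⇒m∸n<o)
open import Data.Nat.DivMod
  using (_%_; _/_; m≡m%n+[m/n]*n; m<n⇒m%n≡m; m%n%n≡m%n; n%n≡0; m*n%n≡0; %-distribˡ-+; %-distribˡ-*;
         m≤n⇒[n∸m]%m≡n%m; m∣n⇒o%n%m≡o%m)
open import Data.Nat.Divisibility using (_∣_; divides; m%n≡0⇒n∣m)
open import Data.Nat.GeneralisedArithmetic using (iterate)
open import Data.Nat.Tactic.RingSolver using (solve-∀)
open import Data.Parity.Base as ℙ using (Parity; 0ℙ; 1ℙ)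
open import Data.Parity.Properties as ℙ using (+-homo-+; *-homo-*)
import Algebra.Properties.Group ℙ.+-0-group as ℙG
open import Data.Fin using (Fin; zero; suc; toℕ; punchIn; _↑ˡ_; _↑ʳ_)
open import Data.Fin.Properties using (toℕ-injective; toℕ-fromℕ<; toℕ<n; punchInᵢ≢i)
import Data.Fin.Properties as F
open import Data.Fin.Subset using (Subset; _∈_)
open import Data.Vec using (lookup)
open import Data.Vec.Properties using ([]=⇒lookup; lookup⇒[]=)
open import Data.Vec.Functional using (removeAt)
open import Data.Product using (Σ; _×_; _,_; proj₁; proj₂; ∃-syntax; uncurry)
open import Data.Product.Properties using (≡-dec)
open import Data.Sum using (_⊎_; inj₁; inj₂)
open import Function.Base using (_∘_)
open import Function.Bundles using (_⇔_; _↔_; mk⇔; mk↔ₛ′; Equivalence; Injection; Inverse)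
open import Function.Construct.Composition using (_⇔-∘_)
open import Function.Construct.Identity using (⇔-id)
open import Function.Construct.Symmetry using (⇔-sym)
open import Function.Properties.Inverse using (↔-trans; ↔-sym; ↔⇒↣)
open import Relation.Binary using (tri<; tri≈; tri>)
open import Relation.Binary.PropositionalEquality
open ≡-Reasoning
open import Relation.Nullary using (Dec; yes; no; ¬_; does; contradiction)
open import Relation.Nullary.Decidable using (isYes; dec-true; dec-false; toWitness; fromWitness; fromWitnessFalse)

∧-≡-true : ∀ a {b} → a ∧ b ≡ true → a ≡ true × b ≡ true
∧-≡-true true refl = refl , refl

module _ {A : Set} (f : A → A) where

  iterate-suc : ∀ x k → iterate f (f x) k ≡ f (iterate f x k)
  iterate-suc x ℕ.zero = refl
  iterate-suc x (ℕ.suc k) = iterate-suc (f x) k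

  iterate-+ : ∀ x m k → iterate f x (m + k) ≡ iterate f (iterate f x m) k
  iterate-+ x ℕ.zero k = refl
  iterate-+ x (ℕ.suc m) k = iterate-+ (f x) m k

  iterate-preserves : ∀ (P : A → Set) → (∀ x → P x → P (f x)) → ∀ {x} k → P x → P (iterate f x k)
  iterate-preserves P f-preserves ℕ.zero Px = Px
  iterate-preserves P f-preserves (ℕ.suc k) Px = iterate-preserves P f-preserves k (f-preserves _ Px)

module ℤₙ (n : ℕ) .{{_ : NonZero n}} where

  toℕ-mod : ∀ m → toℕ (mod n m) ≡ m % n
  toℕ-mod m = toℕ-fromℕ< _

  toℕ-% : (a : Fin n) → toℕ a % n ≡ toℕ a
  toℕ-% a = m<n⇒m%n≡m (toℕ<n a)

  toℕ-0ₙ : toℕ (0ₙ n) ≡ 0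
  toℕ-0ₙ = trans (toℕ-mod 0) (m<n⇒m%n≡m (ℕ.>-nonZero⁻¹ n))

  %-absorbˡ : ∀ x y → (x % n + y) % n ≡ (x + y) % n
  %-absorbˡ x y = begin
    (x % n + y) % n              ≡⟨ %-distribˡ-+ (x % n) y n ⟩
    (x % n % n + y % n) % n      ≡⟨ cong (λ t → (t + y % n) % n) (m%n%n≡m%n x n) ⟩
    (x % n + y % n) % n          ≡⟨ %-distribˡ-+ x y n ⟨
    (x + y) % n                  ∎

  %-absorbʳ-* : ∀ x y → (x * (y % n)) % n ≡ (x * y) % n
  %-absorbʳ-* x y = begin
    (x * (y % n)) % n              ≡⟨ %-distribˡ-* x (y % n) n ⟩
    (x % n * (y % n % n)) % n      ≡⟨ cong (λ t → (x % n * t) % n) (m%n%n≡m%n y n) ⟩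
    (x % n * (y % n)) % n          ≡⟨ %-distribˡ-* x y n ⟨
    (x * y) % n                    ∎

  %-absorbʳ : ∀ x y → (x + y % n) % n ≡ (x + y) % n
  %-absorbʳ x y = begin
    (x + y % n) % n  ≡⟨ cong (_% n) (+-comm x (y % n)) ⟩
    (y % n + x) % n  ≡⟨ %-absorbˡ y x ⟩
    (y + x) % n      ≡⟨ cong (_% n) (+-comm y x) ⟩
    (x + y) % n      ∎

  ⊕-comm : (a b : Fin n) → a ⊕ b ≡ b ⊕ a
  ⊕-comm a b = toℕ-injective (begin
    toℕ (a ⊕ b)            ≡⟨ toℕ-mod _ ⟩
    (toℕ a + toℕ b) % n    ≡⟨ cong (_% n) (+-comm (toℕ a) (toℕ b)) ⟩
    (toℕ b + toℕ a) % n    ≡⟨ toℕ-mod _ ⟨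
    toℕ (b ⊕ a)            ∎)

  ⊕-assoc : (a b c : Fin n) → (a ⊕ b) ⊕ c ≡ a ⊕ (b ⊕ c)
  ⊕-assoc a b c = toℕ-injective (begin
    toℕ ((a ⊕ b) ⊕ c)                  ≡⟨ toℕ-mod _ ⟩
    (toℕ (a ⊕ b) + toℕ c) % n          ≡⟨ cong (λ t → (t + toℕ c) % n) (toℕ-mod _) ⟩
    ((toℕ a + toℕ b) % n + toℕ c) % n  ≡⟨ %-absorbˡ _ _ ⟩
    (toℕ a + toℕ b + toℕ c) % n        ≡⟨ cong (_% n) (+-assoc (toℕ a) _ _) ⟩
    (toℕ a + (toℕ b + toℕ c)) % n      ≡⟨ %-absorbʳ _ _ ⟨
    (toℕ a + (toℕ b + toℕ c) % n) % n  ≡⟨ cong (λ t → (toℕ a + t) % n) (toℕ-mod _) ⟨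
    (toℕ a + toℕ (b ⊕ c)) % n          ≡⟨ toℕ-mod _ ⟨
    toℕ (a ⊕ (b ⊕ c))                  ∎)

  ⊕-identityˡ : (a : Fin n) → 0ₙ n ⊕ a ≡ a
  ⊕-identityˡ a = toℕ-injective (begin
    toℕ (0ₙ n ⊕ a)               ≡⟨ toℕ-mod _ ⟩
    (toℕ (0ₙ n) + toℕ a) % n     ≡⟨ cong (λ t → (t + toℕ a) % n) toℕ-0ₙ ⟩
    toℕ a % n                    ≡⟨ toℕ-% a ⟩
    toℕ a                        ∎)

  ⊕-inverseʳ : (a : Fin n) → a ⊕ ⊝ a ≡ 0ₙ n
  ⊕-inverseʳ a = toℕ-injective (begin
    toℕ (a ⊕ ⊝ a)                    ≡⟨ toℕ-mod _ ⟩
    (toℕ a + toℕ (⊝ a)) % n          ≡⟨ cong (λ t → (toℕ a + t) % n) (toℕ-mod _) ⟩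
    (toℕ a + (n ∸ toℕ a) % n) % n    ≡⟨ %-absorbʳ _ _ ⟩
    (toℕ a + (n ∸ toℕ a)) % n        ≡⟨ cong (_% n) (m+[n∸m]≡n (<⇒≤ (toℕ<n a))) ⟩
    n % n                            ≡⟨ n%n≡0 n ⟩
    0                                ≡⟨ toℕ-0ₙ ⟨
    toℕ (0ₙ n)                       ∎)

  abelianGroup : AbelianGroup 0ℓ 0ℓ
  abelianGroup = record
    { Carrier = Fin n
    ; _≈_ = _≡_
    ; _∙_ = _⊕_
    ; ε = 0ₙ n
    ; _⁻¹ = ⊝_
    ; isAbelianGroup = record
      { isGroup = record
        { isMonoid = record
          { isSemigroup = record
            { isMagma = record { isEquivalence = isEquivalence ; ∙-cong = cong₂ _⊕_ }
            ; assoc = ⊕-assoc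
            }
          ; identity = ⊕-identityˡ , λ a → trans (⊕-comm a _) (⊕-identityˡ a)
          }
        ; inverse = (λ a → trans (⊕-comm (⊝ a) a) (⊕-inverseʳ a)) , ⊕-inverseʳ
        ; ⁻¹-cong = cong ⊝_
        }
      ; comm = ⊕-comm
      }
    }

  open AbelianGroup abelianGroup public using (identityˡ; identityʳ; inverseˡ; inverseʳ; assoc; comm)
  open import Algebra.Properties.AbelianGroup abelianGroup public
  open import Algebra.Properties.CommutativeSemigroup (AbelianGroup.commutativeSemigroup abelianGroup) public
    using (xy∙z≈xz∙y) renaming (interchange to ⊕-interchange)

  ⊕-⊖-cancel : (x y : Fin n) → x ⊕ (y ⊖ x) ≡ y
  ⊕-⊖-cancel x y = trans (comm x (y ⊖ x)) (//-rightDividesˡ x y)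

  ⊖-involutive : (d u : Fin n) → d ⊖ (d ⊖ u) ≡ u
  ⊖-involutive d u = trans (cong (d ⊕_) (⁻¹-anti-homo‿- d u)) (⊕-⊖-cancel d u)

half-of-even : ∀ m → parity m ≡ 0ℙ → ∃[ t ] t + t ≡ m
half-of-even 0 _ = 0 , refl
half-of-even (ℕ.suc (ℕ.suc m)) p with half-of-even m p
... | t , t+t≡m = ℕ.suc t , cong ℕ.suc (trans (+-suc t t) (cong ℕ.suc t+t≡m))

2∣⇒parity≡0ℙ : ∀ {n} → 2 ∣ n → parity n ≡ 0ℙ
2∣⇒parity≡0ℙ {n} (divides q refl) = trans (*-homo-* q 2) (ℙ.*-zeroʳ (parity q))

-- The parity of the representative in [0, n); it is additive on ℤ_n only when n is even.
module _ {n : ℕ} where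

  parityₙ : Fin n → Parity
  parityₙ a = parity (toℕ a)

  Even : Fin n → Set
  Even a = parityₙ a ≡ 0ℙ

  Even? : (a : Fin n) → Dec (Even a)
  Even? a = parityₙ a ℙ.≟ 0ℙ

  SupportedOnEven : (Fin n → Bool) → Set
  SupportedOnEven T = ∀ d → ¬ Even d → T d ≡ false

  SupportedOnEven⇒Even : ∀ {T} → SupportedOnEven T → ∀ d → T d ≡ true → Even d
  SupportedOnEven⇒Even T-supp d Td with Even? d
  ... | yes even = even
  ... | no odd = contradiction (trans (sym Td) (T-supp d odd)) λ ()

module ℤₙ-Parity (n : ℕ) .{{_ : NonZero n}} (2∣n : 2 ∣ n) where
  open ℤₙ n

  parity-% : ∀ m → parity (m % n) ≡ parity m
  parity-% m = sym (begin
    parity m                                     ≡⟨ cong parity (m≡m%n+[m/n]*n m n) ⟩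
    parity (m % n + m / n * n)                   ≡⟨ +-homo-+ (m % n) _ ⟩
    parity (m % n) ℙ.+ parity (m / n * n)        ≡⟨ cong (parity (m % n) ℙ.+_) (*-homo-* (m / n) n) ⟩
    parity (m % n) ℙ.+ (parity (m / n) ℙ.* parity n)
      ≡⟨ cong (λ p → parity (m % n) ℙ.+ (parity (m / n) ℙ.* p)) (2∣⇒parity≡0ℙ 2∣n) ⟩
    parity (m % n) ℙ.+ (parity (m / n) ℙ.* 0ℙ)   ≡⟨ cong (parity (m % n) ℙ.+_) (ℙ.*-zeroʳ _) ⟩
    parity (m % n) ℙ.+ 0ℙ                        ≡⟨ ℙ.+-identityʳ _ ⟩
    parity (m % n)                               ∎)

  0ₙ-Even : Even (0ₙ n)
  0ₙ-Even = cong parity toℕ-0ₙ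

  parityₙ-⊕ : (a b : Fin n) → parityₙ (a ⊕ b) ≡ parityₙ a ℙ.+ parityₙ b
  parityₙ-⊕ a b = trans (cong parity (toℕ-mod _)) (trans (parity-% _) (+-homo-+ (toℕ a) (toℕ b)))

  parityₙ-⊝ : (a : Fin n) → parityₙ (⊝ a) ≡ parityₙ a
  parityₙ-⊝ a = ℙG.x∙y⁻¹≈ε⇒x≈y _ _ (begin
    parityₙ (⊝ a) ℙ.+ parityₙ a   ≡⟨ parityₙ-⊕ (⊝ a) a ⟨
    parityₙ (⊝ a ⊕ a)             ≡⟨ cong parityₙ (inverseˡ a) ⟩
    parityₙ (0ₙ n)                ≡⟨ 0ₙ-Even ⟩
    0ℙ                            ∎)

  parityₙ-⊖ : (a b : Fin n) → parityₙ (a ⊖ b) ≡ parityₙ a ℙ.+ parityₙ b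
  parityₙ-⊖ a b = trans (parityₙ-⊕ a (⊝ b)) (cong (parityₙ a ℙ.+_) (parityₙ-⊝ b))

  Even-⊖⇔ : (a b : Fin n) → Even (a ⊖ b) ⇔ (parityₙ a ≡ parityₙ b)
  Even-⊖⇔ a b = mk⇔
    (λ e → ℙG.x∙y⁻¹≈ε⇒x≈y _ _ (trans (sym (parityₙ-⊖ a b)) e))
    (λ e → trans (parityₙ-⊖ a b) (trans (cong (ℙ._+ parityₙ b) e) (ℙ.p+p≡0ℙ (parityₙ b))))

  Even-⊖-cong : ∀ a a′ b b′ → parityₙ a ≡ parityₙ a′ → parityₙ b ≡ parityₙ b′ →
                Even (a ⊖ b) → Even (a′ ⊖ b′)
  Even-⊖-cong a a′ b b′ pa pb even = begin
    parityₙ (a′ ⊖ b′)              ≡⟨ parityₙ-⊖ a′ b′ ⟩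
    parityₙ a′ ℙ.+ parityₙ b′      ≡⟨ cong₂ ℙ._+_ pa pb ⟨
    parityₙ a ℙ.+ parityₙ b        ≡⟨ parityₙ-⊖ a b ⟨
    parityₙ (a ⊖ b)                ≡⟨ even ⟩
    0ℙ                             ∎

  Even-⊕ : (a b : Fin n) → Even a → Even b → Even (a ⊕ b)
  Even-⊕ a b ea eb = trans (parityₙ-⊕ a b) (cong₂ ℙ._+_ ea eb)

  parityₙ-⊕-Even : (a h : Fin n) → Even h → parityₙ (a ⊕ h) ≡ parityₙ a
  parityₙ-⊕-Even a h eh = trans (parityₙ-⊕ a h) (trans (cong (parityₙ a ℙ.+_) eh) (ℙ.+-identityʳ _))

  ⊕-self-Even : ∀ u → Even (u ⊕ u)
  ⊕-self-Even u = trans (parityₙ-⊕ u u) (ℙ.p+p≡0ℙ (parityₙ u))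

  In2ℤ⇔Even : (x : Fin n) → In2ℤ x ⇔ Even x
  In2ℤ⇔Even x = mk⇔ to from
    where
    to : In2ℤ x → Even x
    to (y , refl) = ⊕-self-Even y
    from : Even x → In2ℤ x
    from ex with half-of-even (toℕ x) ex
    ... | t , t+t≡x = mod n t , toℕ-injective (begin
      toℕ (mod n t ⊕ mod n t)                 ≡⟨ toℕ-mod _ ⟩
      (toℕ (mod n t) + toℕ (mod n t)) % n     ≡⟨ cong (λ s → (s + s) % n) (trans (toℕ-mod t) (m<n⇒m%n≡m t<n)) ⟩
      (t + t) % n                             ≡⟨ cong (_% n) t+t≡x ⟩
      toℕ x % n                               ≡⟨ toℕ-% x ⟩
      toℕ x                                   ∎)
      where
      t<n : t ℕ.< n
      t<n = ≤-<-trans (m≤m+n t t) (subst (ℕ._< n) (sym t+t≡x) (toℕ<n x))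

module GF₂-Sums where
  open import Algebra.Properties.Semiring.Sum (CommutativeRing.semiring xor-∧-commutativeRing) public
    using (sum; sum-cong-≗; sum-permute; ∑-distrib-+; *-distribˡ-sum)
  open import Algebra.Properties.Semiring.Sum (CommutativeRing.semiring xor-∧-commutativeRing)
    using (sum-remove; sum-replicate-zero)

  sum-false : ∀ {k} (f : Fin k → Bool) → (∀ i → f i ≡ false) → sum f ≡ false
  sum-false {k} f f≡false = trans (sum-cong-≗ f≡false) (sum-replicate-zero k)

  sum-single : ∀ {k} (f : Fin k → Bool) (i : Fin k) → (∀ j → f j ≡ true → j ≡ i) → sum f ≡ f i
  sum-single {ℕ.suc k} f i only-i = begin
    sum f                               ≡⟨ sum-remove {i = i} f ⟩
    f i xor sum (removeAt f i)          ≡⟨ cong (f i xor_) (sum-false _ off-i) ⟩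
    f i xor false                       ≡⟨ xor-identityʳ (f i) ⟩
    f i                                 ∎
    where
    off-i : ∀ j → f (punchIn i j) ≡ false
    off-i j with f (punchIn i j) in eq
    ... | false = refl
    ... | true = contradiction (only-i _ eq) (punchInᵢ≢i i j)

  -- Terms of a g-invariant sum cancel in pairs {u, g u}; only the fixed points of g remain.
  sum-involution : ∀ {k} (f : Fin k → Bool) (g : Fin k → Fin k) →
                   (∀ u → g (g u) ≡ u) → (∀ u → f (g u) ≡ f u) →
                   sum f ≡ sum (λ u → f u ∧ does (u F.≟ g u))
  sum-involution {k} f g g-involutive f∘g≗f = begin
    sum f                                     ≡⟨ sum-cong-≗ split ⟩
    sum (λ u → (below u xor above u) xor fixed u)
      ≡⟨ ∑-distrib-+ (λ u → below u xor above u) fixed ⟩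
    sum (λ u → below u xor above u) xor sum fixed
      ≡⟨ cong (_xor sum fixed) (∑-distrib-+ below above) ⟩
    (sum below xor sum above) xor sum fixed   ≡⟨ cong (λ t → (sum below xor t) xor sum fixed) above≡below ⟩
    (sum below xor sum below) xor sum fixed   ≡⟨ cong (_xor sum fixed) (xor-same (sum below)) ⟩
    sum fixed                                 ∎
    where
    below above fixed : Fin k → Bool
    below u = f u ∧ does (u F.<? g u)
    above u = f u ∧ does (g u F.<? u)
    fixed u = f u ∧ does (u F.≟ g u)

    split : ∀ u → f u ≡ (below u xor above u) xor fixed u
    split u with F.<-cmp u (g u)
    ... | tri< u<gu u≢gu gu≮u
      rewrite dec-true (u F.<? g u) u<gu | dec-false (g u F.<? u) gu≮u | dec-false (u F.≟ g u) u≢gu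
      = boolean (f u)
      where
      boolean : ∀ b → b ≡ ((b ∧ true) xor (b ∧ false)) xor (b ∧ false)
      boolean false = refl
      boolean true = refl
    ... | tri≈ u≮gu u≡gu gu≮u
      rewrite dec-false (u F.<? g u) u≮gu | dec-false (g u F.<? u) gu≮u | dec-true (u F.≟ g u) u≡gu
      = boolean (f u)
      where
      boolean : ∀ b → b ≡ ((b ∧ false) xor (b ∧ false)) xor (b ∧ true)
      boolean false = refl
      boolean true = refl
    ... | tri> u≮gu u≢gu gu<u
      rewrite dec-false (u F.<? g u) u≮gu | dec-true (g u F.<? u) gu<u | dec-false (u F.≟ g u) u≢gu
      = boolean (f u)
      where
      boolean : ∀ b → b ≡ ((b ∧ false) xor (b ∧ true)) xor (b ∧ false)
      boolean false = refl
      boolean true = refl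

    above≡below : sum above ≡ sum below
    above≡below = trans (sum-permute above (mk↔ₛ′ g g g-involutive g-involutive))
      (sum-cong-≗ λ u → cong₂ _∧_ (f∘g≗f u) (cong (λ v → does (v F.<? g u)) (g-involutive u)))

  sum-↑ : ∀ m k (g : Fin (m + k) → Bool) →
          sum g ≡ sum (λ i → g (i ↑ˡ k)) xor sum (λ j → g (m ↑ʳ j))
  sum-↑ ℕ.zero k g = refl
  sum-↑ (ℕ.suc m) k g = trans (cong (g zero xor_) (sum-↑ m k (g ∘ suc))) (sym (xor-assoc (g zero) _ _))

  module _ {k : ℕ} where

    ΣV : (Fin k × Bool → Bool) → Bool
    ΣV f = sum (λ v → f (v , false)) xor sum (λ v → f (v , true))

    ⊎↔×Bool : (Fin k ⊎ Fin k) ↔ (Fin k × Bool)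
    ⊎↔×Bool = mk↔ₛ′ to from to∘from from∘to
      where
      to : Fin k ⊎ Fin k → Fin k × Bool
      to (inj₁ v) = v , false
      to (inj₂ v) = v , true
      from : Fin k × Bool → Fin k ⊎ Fin k
      from (v , false) = inj₁ v
      from (v , true) = inj₂ v
      to∘from : ∀ x → to (from x) ≡ x
      to∘from (v , false) = refl
      to∘from (v , true) = refl
      from∘to : ∀ x → from (to x) ≡ x
      from∘to (inj₁ v) = refl
      from∘to (inj₂ v) = refl

    enumerateV : Fin (k + k) ↔ (Fin k × Bool)
    enumerateV = ↔-trans F.+↔⊎ ⊎↔×Bool

    ΣV-enumerate : ∀ f → ΣV f ≡ sum (f ∘ Inverse.to enumerateV)
    ΣV-enumerate f = sym (trans (sum-↑ k k _) (cong₂ _xor_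
      (sum-cong-≗ λ v → cong (f ∘ Inverse.to ⊎↔×Bool) (F.splitAt-↑ˡ k v k))
      (sum-cong-≗ λ v → cong (f ∘ Inverse.to ⊎↔×Bool) (F.splitAt-↑ʳ k k v))))

    ΣV-permute : ∀ f (β : (Fin k × Bool) ↔ (Fin k × Bool)) → ΣV f ≡ ΣV (f ∘ Inverse.to β)
    ΣV-permute f β = begin
      ΣV f                                         ≡⟨ ΣV-enumerate f ⟩
      sum (f ∘ to enumerateV)                      ≡⟨ sum-permute _ π ⟩
      sum (f ∘ to enumerateV ∘ from enumerateV ∘ to β ∘ to enumerateV)
        ≡⟨ sum-cong-≗ {k + k} (λ i → cong f (strictlyInverseˡ enumerateV _)) ⟩
      sum (f ∘ to β ∘ to enumerateV)               ≡⟨ ΣV-enumerate (f ∘ to β) ⟨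
      ΣV (f ∘ to β)                                ∎
      where
      open Inverse
      π : Fin (k + k) ↔ Fin (k + k)
      π = ↔-trans enumerateV (↔-trans β (↔-sym enumerateV))

    infixl 7 _⨾_

    _⨾_ : (R R′ : Fin k × Bool → Fin k × Bool → Bool) → Fin k × Bool → Fin k × Bool → Bool
    (R ⨾ R′) x y = ΣV (λ z → R x z ∧ R′ z y)

    Preserves : ((Fin k × Bool) ↔ (Fin k × Bool)) → (Fin k × Bool → Fin k × Bool → Bool) → Set
    Preserves β R = ∀ x y → R (Inverse.to β x) (Inverse.to β y) ≡ R x y

    ⨾-preserves : ∀ β {R R′} → Preserves β R → Preserves β R′ → Preserves β (R ⨾ R′)
    ⨾-preserves β {R} {R′} βR βR′ x y = begin
      ΣV (λ z → R (to x) z ∧ R′ z (to y))               ≡⟨ ΣV-permute (λ z → R (to x) z ∧ R′ z (to y)) β ⟩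
      ΣV (λ z → R (to x) (to z) ∧ R′ (to z) (to y))
        ≡⟨ cong₂ _xor_ (sum-cong-≗ (same false)) (sum-cong-≗ (same true)) ⟩
      ΣV (λ z → R x z ∧ R′ z y)                         ∎
      where
      open Inverse β
      same : ∀ b v → R (to x) (to (v , b)) ∧ R′ (to (v , b)) (to y) ≡ R x (v , b) ∧ R′ (v , b) y
      same b v = cong₂ _∧_ (βR x (v , b)) (βR′ (v , b) y)

module ℤₙ-Convolution (n : ℕ) .{{_ : NonZero n}} where
  open ℤₙ n
  open GF₂-Sums

  infixl 7 _⋆_ _⨾ᴮ_

  _⋆_ : (D D′ : Fin n → Bool) → Fin n → Bool
  (D ⋆ D′) d = sum (λ u → D u ∧ D′ (d ⊖ u))

  lift : (Bool → Bool → Bool) → (Fin n → Bool) → Fin n × Bool → Fin n × Bool → Bool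
  lift L D (x , a) (y , b) = L a b ∧ D (y ⊖ x)

  square : (Fin n → Bool) → Fin n → Bool
  square D = D ⋆ D

  _⨾ᴮ_ : (L L′ : Bool → Bool → Bool) → Bool → Bool → Bool
  (L ⨾ᴮ L′) a b = (L a false ∧ L′ false b) xor (L a true ∧ L′ true b)

  translation : Fin n → Fin n ↔ Fin n
  translation x = mk↔ₛ′ (x ⊕_) (⊝ x ⊕_) (\\-leftDividesˡ x) (\\-leftDividesʳ x)

  ⊖-⊕ : (y x u : Fin n) → y ⊖ (x ⊕ u) ≡ (y ⊖ x) ⊖ u
  ⊖-⊕ y x u = trans (cong (y ⊕_) (sym (⁻¹-∙-comm x u))) (sym (assoc y (⊝ x) (⊝ u)))

  lift-⨾ : ∀ L L′ D D′ x y → (lift L D ⨾ lift L′ D′) x y ≡ lift (L ⨾ᴮ L′) (D ⋆ D′) x y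
  lift-⨾ L L′ D D′ (x , a) (y , b) = begin
    sum (λ z → part false z) xor sum (λ z → part true z)
      ≡⟨ cong₂ _xor_ (sum-cong-≗ (regroup false)) (sum-cong-≗ (regroup true)) ⟩
    sum (λ z → layers false ∧ F z) xor sum (λ z → layers true ∧ F z)
      ≡⟨ cong₂ _xor_ (*-distribˡ-sum (layers false) F) (*-distribˡ-sum (layers true) F) ⟨
    (layers false ∧ sum F) xor (layers true ∧ sum F)
      ≡⟨ ∧-distribʳ-xor (sum F) (layers false) (layers true) ⟨
    (L ⨾ᴮ L′) a b ∧ sum F
      ≡⟨ cong ((L ⨾ᴮ L′) a b ∧_) sum-F ⟩
    (L ⨾ᴮ L′) a b ∧ (D ⋆ D′) (y ⊖ x) ∎
    where
    part : Bool → Fin n → Bool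
    part l z = lift L D (x , a) (z , l) ∧ lift L′ D′ (z , l) (y , b)
    layers : Bool → Bool
    layers l = L a l ∧ L′ l b
    F : Fin n → Bool
    F z = D (z ⊖ x) ∧ D′ (y ⊖ z)
    regroup : ∀ l z → part l z ≡ layers l ∧ F z
    regroup l z = ∧-interchange (L a l) (D (z ⊖ x)) (L′ l b) (D′ (y ⊖ z))
    sum-F : sum F ≡ (D ⋆ D′) (y ⊖ x)
    sum-F = trans (sum-permute F (translation x))
      (sum-cong-≗ λ u → cong₂ _∧_ (cong D (xyx⁻¹≈y x u)) (cong D′ (⊖-⊕ y x u)))

  ⨾-cong : ∀ {R₁ R₂ R₁′ R₂′ : Fin n × Bool → Fin n × Bool → Bool} →
           (∀ x y → R₁ x y ≡ R₂ x y) → (∀ x y → R₁′ x y ≡ R₂′ x y) →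
           ∀ x y → (R₁ ⨾ R₁′) x y ≡ (R₂ ⨾ R₂′) x y
  ⨾-cong {R₁} {R₂} {R₁′} {R₂′} R₁≗R₂ R₁′≗R₂′ x y =
    cong₂ _xor_ (sum-cong-≗ (same false)) (sum-cong-≗ (same true))
    where
    same : ∀ b v → R₁ x (v , b) ∧ R₁′ (v , b) y ≡ R₂ x (v , b) ∧ R₂′ (v , b) y
    same b v = cong₂ _∧_ (R₁≗R₂ x (v , b)) (R₁′≗R₂′ (v , b) y)

  xnor : Bool → Bool → Bool
  xnor a b = not (a xor b)

  xor-⨾ᴮ-xor : ∀ a b → (_xor_ ⨾ᴮ _xor_) a b ≡ xnor a b
  xor-⨾ᴮ-xor false false = refl
  xor-⨾ᴮ-xor false true = refl
  xor-⨾ᴮ-xor true false = refl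
  xor-⨾ᴮ-xor true true = refl

  xnor-⨾ᴮ-xnor : ∀ a b → (xnor ⨾ᴮ xnor) a b ≡ xnor a b
  xnor-⨾ᴮ-xnor false false = refl
  xnor-⨾ᴮ-xnor false true = refl
  xnor-⨾ᴮ-xnor true false = refl
  xnor-⨾ᴮ-xnor true true = refl

  iterate-⨾-lift-xnor : ∀ k {R D} → (∀ x y → R x y ≡ lift xnor D x y) →
    ∀ x y → iterate (λ R → R ⨾ R) R k x y ≡ lift xnor (iterate square D k) x y
  iterate-⨾-lift-xnor ℕ.zero R≗ = R≗
  iterate-⨾-lift-xnor (ℕ.suc k) {R} {D} R≗ = iterate-⨾-lift-xnor k R⨾R≗
    where
    R⨾R≗ : ∀ x y → (R ⨾ R) x y ≡ lift xnor (D ⋆ D) x y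
    R⨾R≗ x y = trans (⨾-cong R≗ R≗ x y) (trans (lift-⨾ xnor xnor D D x y)
      (cong (_∧ (D ⋆ D) (proj₁ y ⊖ proj₁ x)) (xnor-⨾ᴮ-xnor (proj₂ x) (proj₂ y))))

  iterate-⨾-lift-xor : ∀ k D x y →
    iterate (λ R → R ⨾ R) (lift _xor_ D) (ℕ.suc k) x y ≡ lift xnor (iterate square D (ℕ.suc k)) x y
  iterate-⨾-lift-xor k D = iterate-⨾-lift-xnor k λ x y →
    trans (lift-⨾ _xor_ _xor_ D D x y) (cong (_∧ (D ⋆ D) (proj₁ y ⊖ proj₁ x)) (xor-⨾ᴮ-xor (proj₂ x) (proj₂ y)))

module Frobenius (n : ℕ) .{{_ : NonZero n}} (2∣n : 2 ∣ n)
                 (halve : Fin n → Fin n)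
                 (halve-Even : ∀ d → Even d → Even (halve d))
                 (double-halve : ∀ d → Even d → halve d ⊕ halve d ≡ d)
                 (double-injective : ∀ u v → Even u → Even v → u ⊕ u ≡ v ⊕ v → u ≡ v)
                 where
  open ℤₙ n
  open ℤₙ-Parity n 2∣n
  open GF₂-Sums
  open ℤₙ-Convolution n

  module Square (T : Fin n → Bool) (T-supp : SupportedOnEven T) (d : Fin n) where

    term : Fin n → Bool
    term u = T u ∧ T (d ⊖ u)

    fixedTerm : Fin n → Bool
    fixedTerm u = term u ∧ does (u F.≟ d ⊖ u)

    sum-fixed : (T ⋆ T) d ≡ sum fixedTerm
    sum-fixed = sum-involution term (d ⊖_) (⊖-involutive d)
      λ u → trans (cong (T (d ⊖ u) ∧_) (cong T (⊖-involutive d u))) (∧-comm (T (d ⊖ u)) (T u))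

    fixedTerm-root : ∀ u → fixedTerm u ≡ true → Even u × u ⊕ u ≡ d
    fixedTerm-root u fixed with T u in Tu | u F.≟ d ⊖ u
    ... | true | yes u≡d⊖u = SupportedOnEven⇒Even T-supp u Tu , trans (cong (u ⊕_) u≡d⊖u) (⊕-⊖-cancel u d)
    ... | true | no _ = contradiction (trans (sym fixed) (∧-zeroʳ (T (d ⊖ u)))) λ ()

    ⋆-self-Even : Even d → (T ⋆ T) d ≡ T (halve d)
    ⋆-self-Even even = begin
      (T ⋆ T) d                                      ≡⟨ sum-fixed ⟩
      sum fixedTerm                                  ≡⟨ sum-single fixedTerm (halve d) unique-root ⟩
      (T (halve d) ∧ T (d ⊖ halve d)) ∧ does (halve d F.≟ d ⊖ halve d)
        ≡⟨ cong (λ v → (T (halve d) ∧ T v) ∧ does (halve d F.≟ v)) d⊖halve≡halve ⟩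
      (T (halve d) ∧ T (halve d)) ∧ does (halve d F.≟ halve d)
        ≡⟨ cong₂ _∧_ (∧-idem (T (halve d))) (dec-true (halve d F.≟ halve d) refl) ⟩
      T (halve d) ∧ true                             ≡⟨ ∧-identityʳ (T (halve d)) ⟩
      T (halve d)                                    ∎
      where
      d⊖halve≡halve : d ⊖ halve d ≡ halve d
      d⊖halve≡halve = trans (cong (_⊖ halve d) (sym (double-halve d even))) (xyx⁻¹≈y (halve d) (halve d))
      unique-root : ∀ u → fixedTerm u ≡ true → u ≡ halve d
      unique-root u fixed with fixedTerm-root u fixed
      ... | even-u , u⊕u≡d = double-injective u (halve d) even-u (halve-Even d even) (trans u⊕u≡d (sym (double-halve d even)))

    ⋆-self-odd : ¬ Even d → (T ⋆ T) d ≡ false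
    ⋆-self-odd odd = trans sum-fixed (sum-false fixedTerm no-root)
      where
      no-root : ∀ u → fixedTerm u ≡ false
      no-root u with fixedTerm u in fixed
      ... | false = refl
      ... | true with fixedTerm-root u fixed
      ...   | _ , u⊕u≡d = contradiction (subst Even u⊕u≡d (⊕-self-Even u)) odd

  iterate-square-supported : ∀ k {T} → SupportedOnEven T → SupportedOnEven (iterate square T k)
  iterate-square-supported ℕ.zero T-supp = T-supp
  iterate-square-supported (ℕ.suc k) {T} T-supp =
    iterate-square-supported k (λ d → Square.⋆-self-odd T T-supp d)

  iterate-square-Even : ∀ k {T} → SupportedOnEven T → ∀ d → Even d →
                        iterate square T k d ≡ T (iterate halve d k)
  iterate-square-Even ℕ.zero T-supp d even = refl
  iterate-square-Even (ℕ.suc k) {T} T-supp d even = begin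
    iterate square (T ⋆ T) k d
      ≡⟨ iterate-square-Even k (λ d′ → Square.⋆-self-odd T T-supp d′) d even ⟩
    (T ⋆ T) (iterate halve d k)
      ≡⟨ Square.⋆-self-Even T T-supp _ (iterate-preserves halve Even halve-Even k even) ⟩
    T (halve (iterate halve d k))      ≡⟨ cong T (iterate-suc halve d k) ⟨
    T (iterate halve (halve d) k)      ∎

  iterate-square-period : ∀ P → (∀ d → Even d → iterate halve d P ≡ d) →
                          ∀ {T} → SupportedOnEven T → ∀ d → iterate square T P d ≡ T d
  iterate-square-period P period {T} T-supp d with Even? d
  ... | yes even = trans (iterate-square-Even P T-supp d even) (cong T (period d even))
  ... | no odd = trans (iterate-square-supported P T-supp d odd) (sym (T-supp d odd))

double-%-zero : ∀ {n t} .{{_ : NonZero n}} → t ℕ.< n → (t + t) % n ≡ 0 → t + t ≡ 0 ⊎ t + t ≡ n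
double-%-zero {n} {t} t<n t+t%n≡0 with t + t ℕ.<? n
... | yes t+t<n = inj₁ (trans (sym (m<n⇒m%n≡m t+t<n)) t+t%n≡0)
... | no t+t≮n = inj₂ (≤-antisym (m∸n≡0⇒m≤n t+t∸n≡0) n≤t+t)
  where
  n≤t+t : n ℕ.≤ t + t
  n≤t+t = ≮⇒≥ t+t≮n
  t+t∸n≡0 : t + t ∸ n ≡ 0
  t+t∸n≡0 = begin
    t + t ∸ n          ≡⟨ m<n⇒m%n≡m (m<n+o⇒m∸n<o (t + t) n (+-mono-< t<n t<n)) ⟨
    (t + t ∸ n) % n    ≡⟨ m≤n⇒[n∸m]%m≡n%m n≤t+t ⟩
    (t + t) % n        ≡⟨ t+t%n≡0 ⟩
    0                  ∎

module Halving (n : ℕ) .{{_ : NonZero n}} (n%4≡2 : n % 4 ≡ 2) where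
  open ℤₙ n

  2∣n : 2 ∣ n
  2∣n = m%n≡0⇒n∣m n 2 (trans (sym (m∣n⇒o%n%m≡o%m 2 4 n (divides 2 refl))) (cong (_% 2) n%4≡2))

  open ℤₙ-Parity n 2∣n

  double : Fin n → Fin n
  double u = u ⊕ u

  -- Since n/2 is odd, the only element of order 2 in ℤ_n is n/2, and it is odd.
  double-Even-kernel : ∀ w → Even w → double w ≡ 0ₙ n → w ≡ 0ₙ n
  double-Even-kernel w even dw≡0 with half-of-even (toℕ w) even
  ... | s , s+s≡w with double-%-zero (toℕ<n w) (trans (sym (toℕ-mod _)) (trans (cong toℕ dw≡0) toℕ-0ₙ))
  ...   | inj₁ w+w≡0 = toℕ-injective (trans (m+n≡0⇒m≡0 (toℕ w) w+w≡0) (sym toℕ-0ₙ))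
  ...   | inj₂ w+w≡n = contradiction (begin
          2                    ≡⟨ n%4≡2 ⟨
          n % 4                ≡⟨ cong (_% 4) (trans (sym w+w≡n) (cong₂ _+_ (sym s+s≡w) (sym s+s≡w))) ⟩
          (s + s + (s + s)) % 4 ≡⟨ cong (_% 4) (four-s s) ⟩
          (s * 4) % 4          ≡⟨ m*n%n≡0 s 4 ⟩
          0                    ∎) λ ()
    where
    four-s : ∀ s → s + s + (s + s) ≡ s * 4
    four-s = solve-∀

  double-⊖ : ∀ u v → double (u ⊖ v) ≡ double u ⊖ double v
  double-⊖ u v = trans (⊕-interchange u (⊝ v) u (⊝ v)) (cong (double u ⊕_) (⁻¹-∙-comm v v))

  double-injective : ∀ u v → Even u → Even v → double u ≡ double v → u ≡ v
  double-injective u v even-u even-v du≡dv = x∙y⁻¹≈ε⇒x≈y u v (double-Even-kernel (u ⊖ v) even-u⊖v (begin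
    double (u ⊖ v)             ≡⟨ double-⊖ u v ⟩
    double u ⊖ double v        ≡⟨ x≈y⇒x∙y⁻¹≈ε du≡dv ⟩
    0ₙ n                       ∎))
    where
    even-u⊖v : Even (u ⊖ v)
    even-u⊖v = Equivalence.from (Even-⊖⇔ u v) (trans even-u (sym even-v))

  double-Even : ∀ u → Even (double u)
  double-Even = ⊕-self-Even

  iterate-double-injective : ∀ k u v → Even u → Even v → iterate double u k ≡ iterate double v k → u ≡ v
  iterate-double-injective ℕ.zero u v _ _ eq = eq
  iterate-double-injective (ℕ.suc k) u v even-u even-v eq = double-injective u v even-u even-v
    (iterate-double-injective k (double u) (double v) (double-Even u) (double-Even v) eq)

  toℕ-iterate-double : ∀ u k → toℕ (iterate double u k) ≡ (2 ^ k * toℕ u) % n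
  toℕ-iterate-double u ℕ.zero = trans (sym (toℕ-% u)) (cong (_% n) (sym (*-identityˡ (toℕ u))))
  toℕ-iterate-double u (ℕ.suc k) = begin
    toℕ (iterate double (double u) k)             ≡⟨ toℕ-iterate-double (double u) k ⟩
    (2 ^ k * toℕ (double u)) % n                  ≡⟨ cong (λ t → (2 ^ k * t) % n) (toℕ-mod _) ⟩
    (2 ^ k * ((toℕ u + toℕ u) % n)) % n           ≡⟨ %-absorbʳ-* (2 ^ k) _ ⟩
    (2 ^ k * (toℕ u + toℕ u)) % n                 ≡⟨ cong (_% n) (rearrange (2 ^ k) (toℕ u)) ⟩
    (2 * 2 ^ k * toℕ u) % n                       ∎
    where
    rearrange : ∀ p x → p * (x + x) ≡ 2 * p * x
    rearrange = solve-∀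

  two : Fin n
  two = mod n 2

  two-Even : Even two
  two-Even = trans (cong parity (toℕ-mod 2)) (parity-% 2)

  -- Pigeonhole on the n + 1 values double^i two, then cancel double^i (injective on evens).
  two-period : ∃[ M ] iterate double two (ℕ.suc M) ≡ two
  two-period with F.pigeonhole (n<1+n n) (λ (i : Fin (ℕ.suc n)) → iterate double two (toℕ i))
  ... | i , j , i<j , same = M , sym (iterate-double-injective (toℕ i) _ _ two-Even
        (iterate-preserves double Even (λ u _ → double-Even u) {two} (ℕ.suc M) two-Even) (begin
    iterate double two (toℕ i)                                ≡⟨ same ⟩
    iterate double two (toℕ j)                                ≡⟨ cong (iterate double two) j≡ ⟩
    iterate double two (ℕ.suc M + toℕ i)                      ≡⟨ iterate-+ double two (ℕ.suc M) (toℕ i) ⟩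
    iterate double (iterate double two (ℕ.suc M)) (toℕ i)     ∎))
    where
    M : ℕ
    M = toℕ j ∸ ℕ.suc (toℕ i)
    j≡ : toℕ j ≡ ℕ.suc M + toℕ i
    j≡ = trans (sym (m∸n+n≡m i<j)) (+-suc M (toℕ i))

  M : ℕ
  M = proj₁ two-period

  -- double^(M+1) is multiplication by 2^(M+1), which fixes two and hence every multiple of two.
  double-period : ∀ d → Even d → iterate double d (ℕ.suc M) ≡ d
  double-period d even with half-of-even (toℕ d) even
  ... | s , s+s≡d = toℕ-injective (begin
    toℕ (iterate double d (ℕ.suc M))    ≡⟨ toℕ-iterate-double d (ℕ.suc M) ⟩
    (c * toℕ d) % n                     ≡⟨ cong (λ t → (c * t) % n) (sym s+s≡d) ⟩
    (c * (s + s)) % n                   ≡⟨ cong (_% n) (regroup c s) ⟩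
    (s * (c * 2)) % n                   ≡⟨ %-absorbʳ-* s (c * 2) ⟨
    (s * ((c * 2) % n)) % n             ≡⟨ cong (λ t → (s * t) % n) c*2≡2 ⟩
    (s * (2 % n)) % n                   ≡⟨ %-absorbʳ-* s 2 ⟩
    (s * 2) % n                         ≡⟨ cong (_% n) (trans (*-comm s 2) (cong (s +_) (+-identityʳ s))) ⟩
    (s + s) % n                         ≡⟨ cong (_% n) s+s≡d ⟩
    toℕ d % n                           ≡⟨ toℕ-% d ⟩
    toℕ d                               ∎)
    where
    c : ℕ
    c = 2 ^ ℕ.suc M
    regroup : ∀ c s → c * (s + s) ≡ s * (c * 2)
    regroup = solve-∀
    c*2≡2 : (c * 2) % n ≡ 2 % n
    c*2≡2 = begin
      (c * 2) % n             ≡⟨ %-absorbʳ-* c 2 ⟨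
      (c * (2 % n)) % n       ≡⟨ cong (λ t → (c * t) % n) (toℕ-mod 2) ⟨
      (c * toℕ two) % n       ≡⟨ toℕ-iterate-double two (ℕ.suc M) ⟨
      toℕ (iterate double two (ℕ.suc M))  ≡⟨ cong toℕ (proj₂ two-period) ⟩
      toℕ two                 ≡⟨ toℕ-mod 2 ⟩
      2 % n                   ∎

  halve : Fin n → Fin n
  halve d = iterate double d M

  halve-Even : ∀ d → Even d → Even (halve d)
  halve-Even d = iterate-preserves double Even (λ u _ → double-Even u) M

  double-halve : ∀ d → Even d → double (halve d) ≡ d
  double-halve d even = trans (sym (iterate-suc double d M)) (double-period d even)

  iterate-double-halve : ∀ k d → Even d → iterate double (iterate halve d k) k ≡ d
  iterate-double-halve ℕ.zero d even = refl
  iterate-double-halve (ℕ.suc k) d even = begin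
    iterate double (double (iterate halve (halve d) k)) k   ≡⟨ iterate-suc double _ k ⟩
    double (iterate double (iterate halve (halve d) k) k)   ≡⟨ cong double (iterate-double-halve k (halve d) (halve-Even d even)) ⟩
    double (halve d)                                        ≡⟨ double-halve d even ⟩
    d                                                       ∎

  halve-period : ∀ d → Even d → iterate halve d (ℕ.suc M) ≡ d
  halve-period d even = begin
    iterate halve d (ℕ.suc M)
      ≡⟨ double-period _ (iterate-preserves halve Even halve-Even (ℕ.suc M) even) ⟨
    iterate double (iterate halve d (ℕ.suc M)) (ℕ.suc M)
      ≡⟨ iterate-double-halve (ℕ.suc M) d even ⟩
    d ∎

module CanonicalDoubleCover (n : ℕ) .{{_ : NonZero n}} (S : Subset n) where

  flip : Fin n × Bool → Fin n × Bool
  flip (v , a) = v , not a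

  module _ (α : AutBX S) where
    open Inverse (proj₁ α)

    untwisted? : ∀ v → Dec (to (v , true) ≡ flip (to (v , false)))
    untwisted? v = ≡-dec F._≟_ Bool._≟_ _ _

    -- The layer of α (v , 0) is constant along the edges of X, hence constant.
    untwisted⇒layer-shift : Connected S → (∀ v → to (v , true) ≡ flip (to (v , false))) →
                            ∃[ t ] ∀ v i → to (v , i) ≡ (proj₁ (to (v , false)) , t xor i)
    untwisted⇒layer-shift connected untwisted = layer (0ₙ n) , α-form
      where
      layer : Fin n → Bool
      layer v = proj₂ (to (v , false))

      layer-edge : ∀ {u v} → Adj S u v → layer u ≡ layer v
      layer-edge {u} {v} adj with Equivalence.to (proj₂ α (u , false) (v , true)) ((λ ()) , adj)
      ... | layers-differ , _ rewrite untwisted v = trans (¬-not layers-differ) (not-involutive (layer v))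

      layer-walk : ∀ {u v} → Walk S u v → layer u ≡ layer v
      layer-walk nil = refl
      layer-walk (cons adj walk) = trans (layer-edge adj) (layer-walk walk)

      α-form : ∀ v i → to (v , i) ≡ (proj₁ (to (v , false)) , layer (0ₙ n) xor i)
      α-form v false = cong (_ ,_) (trans (layer-walk (connected v (0ₙ n))) (sym (xor-identityʳ _)))
      α-form v true = trans (untwisted v) (cong (_ ,_) (trans (cong not (layer-walk (connected v (0ₙ n))))
                                                         (xor-comm true _)))

    layer-shift⇒InAutX×S₂ : ∀ t → (∀ v i → to (v , i) ≡ (proj₁ (to (v , false)) , t xor i)) → InAutX×S₂ S α
    layer-shift⇒InAutX×S₂ t α-form = (φ↔ , φ-adjacency) , shift↔ , α-form
      where
      φ : Fin n → Fin n
      φ v = proj₁ (to (v , false))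

      φ⁻¹ : Fin n → Fin n
      φ⁻¹ u = proj₁ (from (u , t))

      to-false : ∀ v → to (v , false) ≡ (φ v , t)
      to-false v = trans (α-form v false) (cong (φ v ,_) (xor-identityʳ t))

      φ↔ : Fin n ↔ Fin n
      φ↔ = mk↔ₛ′ φ φ⁻¹
        (λ u → cong proj₁ (trans (sym (α-form _ _)) (strictlyInverseˡ (u , t))))
        (λ v → cong proj₁ (trans (cong from (sym (to-false v))) (strictlyInverseʳ (v , false))))

      layers-differ : t xor false ≢ t xor true
      layers-differ eq = not-¬ refl (trans (sym (xor-identityʳ t)) (trans eq (xor-comm t true)))

      φ-adjacency : ∀ v w → Adj S v w ⇔ Adj S (φ v) (φ w)
      φ-adjacency v w = mk⇔
        (λ adj → proj₂ (subst₂ (BAdj S) (α-form v false) (α-form w true)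
                          (Equivalence.to (proj₂ α (v , false) (w , true)) ((λ ()) , adj))))
        (λ adj → proj₂ (Equivalence.from (proj₂ α (v , false) (w , true))
                          (subst₂ (BAdj S) (sym (α-form v false)) (sym (α-form w true)) (layers-differ , adj))))

      shift↔ : Bool ↔ Bool
      shift↔ = mk↔ₛ′ (t xor_) (t xor_) involutive involutive
        where
        involutive : ∀ b → t xor (t xor b) ≡ b
        involutive b = trans (sym (xor-assoc t t b)) (cong (_xor b) (xor-same t))

module EvenEdges (n : ℕ) .{{_ : NonZero n}} (2∣n : 2 ∣ n) (S : Subset n) where
  open ℤₙ n
  open ℤₙ-Parity n 2∣n
  open GF₂-Sums
  open ℤₙ-Convolution n
  open CanonicalDoubleCover n S

  evenS : Fin n → Bool
  evenS d = lookup S d ∧ isYes (Even? d)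

  evenS-true⇔ : ∀ d → evenS d ≡ true ⇔ (d ∈ S × Even d)
  evenS-true⇔ d = mk⇔
    (λ evenS≡true → let (d∈S , even) = ∧-≡-true (lookup S d) evenS≡true in
                    lookup⇒[]= d S d∈S , toWitness (Equivalence.from T-≡ even))
    (λ (d∈S , even) → cong₂ _∧_ ([]=⇒lookup d∈S) (Equivalence.to T-≡ (fromWitness even)))

  evenS-supported : SupportedOnEven evenS
  evenS-supported d odd =
    trans (cong (lookup S d ∧_) (Equivalence.to T-not-≡ (fromWitnessFalse odd))) (∧-zeroʳ (lookup S d))

  -- Z: the edges of BX whose ends have ℤ_n-parts of equal parity. Zᶠ: the same differences inside each layer.
  Z Zᶠ : Fin n × Bool → Fin n × Bool → Bool
  Z = lift _xor_ evenS
  Zᶠ = lift xnor evenS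

  Z-flip : ∀ x y → Z (flip x) y ≡ Zᶠ x y
  Z-flip (x , a) (y , b) = cong (_∧ evenS (y ⊖ x)) (sym (not-distribˡ-xor a b))

  Z-true⇔ : ∀ x y → Z x y ≡ true ⇔ (BAdj S x y × Even (proj₁ y ⊖ proj₁ x))
  Z-true⇔ (x , a) (y , b) = mk⇔ to from
    where
    xor-true : ∀ a b → a xor b ≡ true → a ≢ b
    xor-true false false ()
    xor-true true true ()
    xor-true false true _ ()
    xor-true true false _ ()
    ≢⇒xor-true : ∀ a b → a ≢ b → a xor b ≡ true
    ≢⇒xor-true false false a≢b = contradiction refl a≢b
    ≢⇒xor-true false true _ = refl
    ≢⇒xor-true true false _ = refl
    ≢⇒xor-true true true a≢b = contradiction refl a≢b
    to : Z (x , a) (y , b) ≡ true → BAdj S (x , a) (y , b) × Even (y ⊖ x)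
    to Z≡true with a xor b in a⊕b | evenS (y ⊖ x) in e
    ... | true | true = let (y⊖x∈S , even) = Equivalence.to (evenS-true⇔ (y ⊖ x)) e in
                        (xor-true a b a⊕b , y⊖x∈S) , even
    from : BAdj S (x , a) (y , b) × Even (y ⊖ x) → Z (x , a) (y , b) ≡ true
    from ((a≢b , y⊖x∈S) , even) =
      cong₂ _∧_ (≢⇒xor-true a b a≢b) (Equivalence.from (evenS-true⇔ (y ⊖ x)) (y⊖x∈S , even))

  module _ (α : AutBX S) (fixes : FixesEvenSetwise S α) where
    open Inverse (proj₁ α)

    α-parity : ∀ x → parityₙ (proj₁ (to x)) ≡ parityₙ (proj₁ x)
    α-parity x with parityₙ (proj₁ x) in px | parityₙ (proj₁ (to x)) in pαx
    ... | 0ℙ | 0ℙ = refl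
    ... | 1ℙ | 1ℙ = refl
    ... | 0ℙ | 1ℙ = contradiction (trans (sym pαx) αx-Even) λ ()
      where
      αx-Even : Even (proj₁ (to x))
      αx-Even = Equivalence.to (In2ℤ⇔Even _)
        (Equivalence.from (fixes (to x)) (x , Equivalence.from (In2ℤ⇔Even _) px , refl))
    ... | 1ℙ | 0ℙ with Equivalence.to (fixes (to x)) (Equivalence.from (In2ℤ⇔Even _) pαx)
    ...   | x′ , x′-even , αx′≡αx = contradiction (trans (sym px) x-Even) λ ()
      where
      x-Even : Even (proj₁ x)
      x-Even = subst (Even ∘ proj₁) (Injection.injective (↔⇒↣ (proj₁ α)) αx′≡αx)
                     (Equivalence.to (In2ℤ⇔Even _) x′-even)

    α-preserves-Z : Preserves (proj₁ α) Z
    α-preserves-Z x y = ⇔→≡ (mk⇔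
      (λ Z≡true → let (adj , even) = Equivalence.to (Z-true⇔ (to x) (to y)) Z≡true in
        Equivalence.from (Z-true⇔ x y) (Equivalence.from (proj₂ α x y) adj ,
          Even-⊖-cong (proj₁ (to y)) (proj₁ y) (proj₁ (to x)) (proj₁ x) (α-parity y) (α-parity x) even))
      (λ Z≡true → let (adj , even) = Equivalence.to (Z-true⇔ x y) Z≡true in
        Equivalence.from (Z-true⇔ (to x) (to y)) (Equivalence.to (proj₂ α x y) adj ,
          Even-⊖-cong (proj₁ y) (proj₁ (to y)) (proj₁ x) (proj₁ (to x)) (sym (α-parity y)) (sym (α-parity x)) even)))

  InSEven⇔evenS : ∀ d → InSEven S d ⇔ evenS d ≡ true
  InSEven⇔evenS d = mk⇔
    (λ (d∈S , d∈2ℤ) → Equivalence.from (evenS-true⇔ d) (d∈S , Equivalence.to (In2ℤ⇔Even d) d∈2ℤ))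
    (λ evenS≡true → let (d∈S , even) = Equivalence.to (evenS-true⇔ d) evenS≡true in
                    d∈S , Equivalence.from (In2ℤ⇔Even d) even)

  period⇒WilsonC1 : ∀ h → Even h → h ≢ 0ₙ n → (∀ d → evenS (h ⊕ d) ≡ evenS d) → WilsonC1 S
  period⇒WilsonC1 h even h≢0 period = h , Equivalence.from (In2ℤ⇔Even h) even , h≢0 , λ x → mk⇔
    (λ x∈ → ⊝ h ⊕ x , Equivalence.from (InSEven⇔evenS _)
      (trans (sym (period _)) (trans (cong evenS (\\-leftDividesˡ h x)) (Equivalence.to (InSEven⇔evenS x) x∈)))
      , sym (\\-leftDividesˡ h x))
    (λ { (a , a∈ , refl) → Equivalence.from (InSEven⇔evenS _) (trans (period a) (Equivalence.to (InSEven⇔evenS a) a∈)) })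

  -- Z (p , a) (p ⊕ d , not a) is evenS d, so twins (p , a) ≢ (q , b) make p ⊖ q a period of evenS.
  twins⇒WilsonC1 : ∀ p q → (∀ y → Z p y ≡ Z q y) → p ≢ q → parityₙ (proj₁ p) ≡ parityₙ (proj₁ q) →
                   ∃[ s ] evenS s ≡ true → WilsonC1 S
  twins⇒WilsonC1 (p , a) (q , b) twins p≢q same-parity (s , evenS-s) =
    period⇒WilsonC1 h (Equivalence.from (Even-⊖⇔ p q) same-parity) h≢0 period
    where
    h : Fin n
    h = p ⊖ q

    Z-from-p : ∀ d → Z (p , a) (p ⊕ d , not a) ≡ evenS d
    Z-from-p d = cong₂ _∧_ (xor-inverseʳ a) (cong evenS (xyx⁻¹≈y p d))

    Z-from-q : ∀ d → Z (q , b) (p ⊕ d , not a) ≡ (b xor not a) ∧ evenS (h ⊕ d)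
    Z-from-q d = cong ((b xor not a) ∧_) (cong evenS (xy∙z≈xz∙y p d (⊝ q)))

    b≡a : b ≡ a
    b≡a = xor-not-true (proj₁ (∧-≡-true (b xor not a) (begin
      (b xor not a) ∧ evenS (h ⊕ s)      ≡⟨ Z-from-q s ⟨
      Z (q , b) (p ⊕ s , not a)          ≡⟨ twins _ ⟨
      Z (p , a) (p ⊕ s , not a)          ≡⟨ Z-from-p s ⟩
      evenS s                            ≡⟨ evenS-s ⟩
      true                               ∎)))
      where
      xor-not-true : ∀ {b a} → b xor not a ≡ true → b ≡ a
      xor-not-true {false} {false} _ = refl
      xor-not-true {true} {true} _ = refl

    period : ∀ d → evenS (h ⊕ d) ≡ evenS d
    period d = begin
      evenS (h ⊕ d)                           ≡⟨ cong (_∧ evenS (h ⊕ d)) (xor-inverseʳ a) ⟨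
      (a xor not a) ∧ evenS (h ⊕ d)           ≡⟨ cong (λ c → (c xor not a) ∧ evenS (h ⊕ d)) b≡a ⟨
      (b xor not a) ∧ evenS (h ⊕ d)           ≡⟨ Z-from-q d ⟨
      Z (q , b) (p ⊕ d , not a)               ≡⟨ twins _ ⟨
      Z (p , a) (p ⊕ d , not a)               ≡⟨ Z-from-p d ⟩
      evenS d                                 ∎

    h≢0 : h ≢ 0ₙ n
    h≢0 h≡0 = p≢q (cong₂ _,_ (x∙y⁻¹≈ε⇒x≈y p q h≡0) (sym b≡a))

  NonBipartite⇒∃evenS : NonBipartite S → ∃[ s ] evenS s ≡ true
  NonBipartite⇒∃evenS non-bipartite with F.any? (λ s → evenS s Bool.≟ true)
  ... | yes found = found
  ... | no none = contradiction (colour , proper) non-bipartite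
    where
    colour : Fin n → Bool
    colour v = does (Even? v)

    same-colour⇒same-parity : ∀ v w → colour v ≡ colour w → parityₙ v ≡ parityₙ w
    same-colour⇒same-parity v w same with Even? v | Even? w
    ... | yes even-v | yes even-w = trans even-v (sym even-w)
    ... | no odd-v | no odd-w = trans (odd⇒1ℙ odd-v) (sym (odd⇒1ℙ odd-w))
      where
      odd⇒1ℙ : ∀ {p} → p ≢ 0ℙ → p ≡ 1ℙ
      odd⇒1ℙ {0ℙ} p≢0ℙ = contradiction refl p≢0ℙ
      odd⇒1ℙ {1ℙ} _ = refl

    proper : ∀ v w → Adj S v w → colour v ≢ colour w
    proper v w adj same = none (w ⊖ v , Equivalence.from (evenS-true⇔ (w ⊖ v))
      (adj , Equivalence.from (Even-⊖⇔ w v) (sym (same-colour⇒same-parity v w same))))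

module DoubleCover (n : ℕ) .{{_ : NonZero n}} (n%4≡2 : n % 4 ≡ 2) (S : Subset n) where
  open Halving n n%4≡2
  open GF₂-Sums
  open ℤₙ-Convolution n
  open Frobenius n 2∣n halve halve-Even double-halve double-injective
  open CanonicalDoubleCover n S
  open EvenEdges n 2∣n S

  Zᶠ-power : ∀ x y → iterate (λ R → R ⨾ R) Z (ℕ.suc M) x y ≡ Zᶠ x y
  Zᶠ-power x y = trans (iterate-⨾-lift-xor M evenS x y)
    (cong (xnor (proj₂ x) (proj₂ y) ∧_) (iterate-square-period (ℕ.suc M) halve-period evenS-supported _))

  module _ (α : AutBX S) (fixes : FixesEvenSetwise S α) where
    open Inverse (proj₁ α)

    α-preserves-Zᶠ : Preserves (proj₁ α) Zᶠ
    α-preserves-Zᶠ x y = begin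
      Zᶠ (to x) (to y)                                       ≡⟨ Zᶠ-power (to x) (to y) ⟨
      iterate (λ R → R ⨾ R) Z (ℕ.suc M) (to x) (to y)        ≡⟨ powers-preserved (ℕ.suc M) x y ⟩
      iterate (λ R → R ⨾ R) Z (ℕ.suc M) x y                  ≡⟨ Zᶠ-power x y ⟩
      Zᶠ x y                                                 ∎
      where
      powers-preserved : ∀ k → Preserves (proj₁ α) (iterate (λ R → R ⨾ R) Z k)
      powers-preserved k = iterate-preserves (λ R → R ⨾ R) (Preserves (proj₁ α))
        (λ R αR → ⨾-preserves (proj₁ α) αR αR) k (α-preserves-Z α fixes)

    twisted-twins : ∀ x y → Z (to (flip x)) y ≡ Z (flip (to x)) y
    twisted-twins x y = begin
      Z (to (flip x)) y                 ≡⟨ cong (Z (to (flip x))) (strictlyInverseˡ y) ⟨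
      Z (to (flip x)) (to (from y))     ≡⟨ α-preserves-Z α fixes (flip x) (from y) ⟩
      Z (flip x) (from y)               ≡⟨ Z-flip x (from y) ⟩
      Zᶠ x (from y)                     ≡⟨ α-preserves-Zᶠ x (from y) ⟨
      Zᶠ (to x) (to (from y))           ≡⟨ cong (Zᶠ (to x)) (strictlyInverseˡ y) ⟩
      Zᶠ (to x) y                       ≡⟨ Z-flip (to x) y ⟨
      Z (flip (to x)) y                 ∎

  unexpected-automorphism⇒WilsonC1 : Connected S → NonBipartite S →
    (α : AutBX S) → ¬ InAutX×S₂ S α → FixesEvenSetwise S α → WilsonC1 S
  unexpected-automorphism⇒WilsonC1 connected non-bipartite α α∉ fixes with F.all? (untwisted? α)
  ... | yes untwisted =
    contradiction (uncurry (layer-shift⇒InAutX×S₂ α) (untwisted⇒layer-shift α connected untwisted)) α∉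
  ... | no twisted with F.¬∀⟶∃¬ n _ (untwisted? α) twisted
  ...   | v , twist = twins⇒WilsonC1 _ _ (twisted-twins α fixes (v , false)) twist
            (trans (α-parity α fixes (v , true)) (sym (α-parity α fixes (v , false))))
            (NonBipartite⇒∃evenS non-bipartite)

module LayerShift (n : ℕ) .{{_ : NonZero n}} (2∣n : 2 ∣ n) (S : Subset n)
                  (h : Fin n) (h-Even : Even h)
                  (h-period : ∀ d → Even d → d ∈ S ⇔ (h ⊕ d) ∈ S) where
  open ℤₙ n
  open ℤₙ-Parity n 2∣n

  -- The vertices (v , i) with v ≡ i (mod 2) are translated by h; the others stay fixed.
  moved : Parity → Bool → Bool
  moved 0ℙ i = i
  moved 1ℙ i = not i

  move unmove : Bool → Fin n → Fin n
  move c v = if c then v ⊕ h else v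
  unmove c v = if c then v ⊖ h else v

  move-parity : ∀ c v → parityₙ (move c v) ≡ parityₙ v
  move-parity false v = refl
  move-parity true v = parityₙ-⊕-Even v h h-Even

  unmove-parity : ∀ c v → parityₙ (unmove c v) ≡ parityₙ v
  unmove-parity false v = refl
  unmove-parity true v = parityₙ-⊕-Even v (⊝ h) (trans (parityₙ-⊝ h) h-Even)

  shift shift⁻¹ : Fin n × Bool → Fin n × Bool
  shift (v , i) = move (moved (parityₙ v) i) v , i
  shift⁻¹ (v , i) = unmove (moved (parityₙ v) i) v , i

  shift-parity : ∀ x → parityₙ (proj₁ (shift x)) ≡ parityₙ (proj₁ x)
  shift-parity (v , i) = move-parity (moved (parityₙ v) i) v

  shift⁻¹-parity : ∀ x → parityₙ (proj₁ (shift⁻¹ x)) ≡ parityₙ (proj₁ x)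
  shift⁻¹-parity (v , i) = unmove-parity (moved (parityₙ v) i) v

  shift↔ : (Fin n × Bool) ↔ (Fin n × Bool)
  shift↔ = mk↔ₛ′ shift shift⁻¹ shift∘shift⁻¹ shift⁻¹∘shift
    where
    shift∘shift⁻¹ : ∀ x → shift (shift⁻¹ x) ≡ x
    shift∘shift⁻¹ (v , i) rewrite unmove-parity (moved (parityₙ v) i) v with moved (parityₙ v) i
    ... | false = refl
    ... | true = cong (_, i) (//-rightDividesˡ h v)
    shift⁻¹∘shift : ∀ x → shift⁻¹ (shift x) ≡ x
    shift⁻¹∘shift (v , i) rewrite move-parity (moved (parityₙ v) i) v with moved (parityₙ v) i
    ... | false = refl
    ... | true = cong (_, i) (//-rightDividesʳ h v)

  ∈-cong : ∀ {d e} → d ≡ e → d ∈ S ⇔ e ∈ S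
  ∈-cong d≡e = mk⇔ (subst (_∈ S) d≡e) (subst (_∈ S) (sym d≡e))

  ⊝h-period : ∀ d → Even d → d ∈ S ⇔ (⊝ h ⊕ d) ∈ S
  ⊝h-period d even = ⇔-sym (∈-cong (\\-leftDividesˡ h d) ⇔-∘ h-period (⊝ h ⊕ d) (Even-⊕ (⊝ h) d ⊝h-Even even))
    where
    ⊝h-Even : Even (⊝ h)
    ⊝h-Even = trans (parityₙ-⊝ h) h-Even

  both-moved : ∀ v w → (w ⊖ v) ∈ S ⇔ ((w ⊕ h) ⊖ (v ⊕ h)) ∈ S
  both-moved v w = ∈-cong (sym (begin
    (w ⊕ h) ⊖ (v ⊕ h)          ≡⟨ cong ((w ⊕ h) ⊕_) (⁻¹-∙-comm v h) ⟨
    (w ⊕ h) ⊕ (⊝ v ⊕ ⊝ h)      ≡⟨ ⊕-interchange w h (⊝ v) (⊝ h) ⟩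
    (w ⊖ v) ⊕ (h ⊖ h)          ≡⟨ cong ((w ⊖ v) ⊕_) (inverseʳ h) ⟩
    (w ⊖ v) ⊕ 0ₙ n             ≡⟨ identityʳ (w ⊖ v) ⟩
    w ⊖ v                      ∎))
  target-moved : ∀ v w → parityₙ w ≡ parityₙ v → (w ⊖ v) ∈ S ⇔ ((w ⊕ h) ⊖ v) ∈ S
  target-moved v w same = ∈-cong (sym (trans (xy∙z≈xz∙y w h (⊝ v)) (comm (w ⊖ v) h)))
                      ⇔-∘ h-period (w ⊖ v) (Equivalence.from (Even-⊖⇔ w v) same)
  source-moved : ∀ v w → parityₙ w ≡ parityₙ v → (w ⊖ v) ∈ S ⇔ (w ⊖ (v ⊕ h)) ∈ S
  source-moved v w same = ∈-cong (sym (trans (cong (w ⊕_) (sym (⁻¹-∙-comm v h)))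
                                   (trans (sym (assoc w (⊝ v) (⊝ h))) (comm (w ⊖ v) (⊝ h)))))
                      ⇔-∘ ⊝h-period (w ⊖ v) (Equivalence.from (Even-⊖⇔ w v) same)

  differences : ∀ v w i j → i ≢ j →
                (w ⊖ v) ∈ S ⇔ (move (moved (parityₙ w) j) w ⊖ move (moved (parityₙ v) i) v) ∈ S
  differences v w i j i≢j with parityₙ v in pv | parityₙ w in pw | i | j
  ... | _ | _ | false | false = contradiction refl i≢j
  ... | _ | _ | true | true = contradiction refl i≢j
  ... | 0ℙ | 1ℙ | false | true = ⇔-id _
  ... | 1ℙ | 0ℙ | true | false = ⇔-id _
  ... | 0ℙ | 1ℙ | true | false = both-moved v w
  ... | 1ℙ | 0ℙ | false | true = both-moved v w
  ... | 0ℙ | 0ℙ | false | true = target-moved v w (trans pw (sym pv))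
  ... | 1ℙ | 1ℙ | true | false = target-moved v w (trans pw (sym pv))
  ... | 0ℙ | 0ℙ | true | false = source-moved v w (trans pw (sym pv))
  ... | 1ℙ | 1ℙ | false | true = source-moved v w (trans pw (sym pv))

  shift-adjacency : ∀ x y → BAdj S x y ⇔ BAdj S (shift x) (shift y)
  shift-adjacency (v , i) (w , j) = mk⇔
    (λ (i≢j , adj) → i≢j , Equivalence.to (differences v w i j i≢j) adj)
    (λ (i≢j , adj) → i≢j , Equivalence.from (differences v w i j i≢j) adj)

  shiftAut : AutBX S
  shiftAut = shift↔ , shift-adjacency

  shift-fixes-even : FixesEvenSetwise S shiftAut
  shift-fixes-even y = mk⇔
    (λ y∈2ℤ → shift⁻¹ y , In2ℤ-parity (shift⁻¹-parity y) y∈2ℤ , Inverse.strictlyInverseˡ shift↔ y)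
    (λ { (x , x∈2ℤ , refl) → In2ℤ-parity (shift-parity x) x∈2ℤ })
    where
    In2ℤ-parity : ∀ {a b} → parityₙ b ≡ parityₙ a → In2ℤ a → In2ℤ b
    In2ℤ-parity {a} {b} same a∈2ℤ =
      Equivalence.from (In2ℤ⇔Even b) (trans same (Equivalence.to (In2ℤ⇔Even a) a∈2ℤ))

  shift-Even : ∀ v → Even v → shift (v , true) ≡ (v ⊕ h , true) × shift (v , false) ≡ (v , false)
  shift-Even v even rewrite even = refl , refl

  shift∉AutX×S₂ : h ≢ 0ₙ n → ¬ InAutX×S₂ S shiftAut
  shift∉AutX×S₂ h≢0 ((φ , _) , _ , product-form) = h≢0 (begin
    h                              ≡⟨ identityˡ h ⟨
    0ₙ n ⊕ h                       ≡⟨ cong proj₁ (trans (sym (proj₁ shift-0)) (product-form (0ₙ n) true)) ⟩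
    Inverse.to φ (0ₙ n)            ≡⟨ cong proj₁ (trans (sym (proj₂ shift-0)) (product-form (0ₙ n) false)) ⟨
    0ₙ n                           ∎)
    where
    shift-0 : shift (0ₙ n , true) ≡ (0ₙ n ⊕ h , true) × shift (0ₙ n , false) ≡ (0ₙ n , false)
    shift-0 = shift-Even (0ₙ n) 0ₙ-Even

WilsonC1⇒unexpected-automorphism : ∀ n .{{_ : NonZero n}} → 2 ∣ n → (S : Subset n) → WilsonC1 S →
  Σ (AutBX S) λ α → ¬ InAutX×S₂ S α × FixesEvenSetwise S α
WilsonC1⇒unexpected-automorphism n 2∣n S (h , h∈2ℤ , h≢0 , translates) =
  shiftAut , shift∉AutX×S₂ h≢0 , shift-fixes-even
  where
  open ℤₙ n
  open ℤₙ-Parity n 2∣n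

  h-period : ∀ d → Even d → d ∈ S ⇔ (h ⊕ d) ∈ S
  h-period d even = mk⇔
    (λ d∈S → proj₁ (Equivalence.from (translates (h ⊕ d)) (d , (d∈S , d∈2ℤ) , refl)))
    (λ h⊕d∈S → let (a , (a∈S , _) , h⊕d≡h⊕a) = Equivalence.to (translates (h ⊕ d)) (h⊕d∈S , h⊕d∈2ℤ)
               in subst (_∈ S) (sym (∙-cancelˡ h d a h⊕d≡h⊕a)) a∈S)
    where
    d∈2ℤ : In2ℤ d
    d∈2ℤ = Equivalence.from (In2ℤ⇔Even d) even
    h⊕d∈2ℤ : In2ℤ (h ⊕ d)
    h⊕d∈2ℤ = Equivalence.from (In2ℤ⇔Even (h ⊕ d)) (Even-⊕ h d (Equivalence.to (In2ℤ⇔Even h) h∈2ℤ) even)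

  open LayerShift n 2∣n S h (Equivalence.to (In2ℤ⇔Even h) h∈2ℤ) h-period

lemma5p2 : (n : ℕ) .{{_ : NonZero n}} → n % 4 ≡ 2 →
    (S : Subset n) → IsConnectionSet S → Connected S → NonBipartite S →
    WilsonC1 S ⇔ (Σ (AutBX S) λ α → ¬ InAutX×S₂ S α × FixesEvenSetwise S α)
lemma5p2 n n%4≡2 S _ connected non-bipartite = mk⇔
  (WilsonC1⇒unexpected-automorphism n (Halving.2∣n n n%4≡2) S)
  (λ (α , α∉ , fixes) → unexpected-automorphism⇒WilsonC1 connected non-bipartite α α∉ fixes)
  where
  open DoubleCover n n%4≡2 S
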